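{- For all $n\geq k+2$, $sat(n,K_{2}\vee P_{k})\leq 2n-3+sat(n-2,P_{k})$.
   Context: All graphs are finite and simple. $P_k$ is the path on $k$ vertices and $K_2$ the complete graph on 2 vertices; $G_1\vee G_2$ denotes the join (disjoint union plus all edges between the two parts). A graph $G$ is $H$-saturated if it contains no copy of $H$ but adding any missing edge creates a copy of $H$; $sat(n,H)$ is the minimum number of edges of an $H$-saturated graph on $n$ vertices. -}

module Defs where

open import Data.Nat using (ℕ; zero; suc; _+_; _≤_; _<ᵇ_; _≡ᵇ_)
open import Data.Fin using (Fin; toℕ; _≟_)
open import Data.Bool using (Bool; true; false; _∧_; _∨_; not; if_then_else_; T)
open import Data.Bool.Properties using (∨-comm; ∧-comm)
open import Data.List using (List; map)
open import Data.Nat.ListAction using (sum)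
open import Data.List.Base using (allFin)
open import Data.Product using (Σ; _×_; ∃)
open import Relation.Binary.PropositionalEquality using (_≡_; refl; cong; cong₂)
open import Relation.Nullary using (¬_; does)
open import Function.Definitions using (Injective)

record Graph (n : ℕ) : Set where
  field
    adj    : Fin n → Fin n → Bool
    sym    : ∀ i j → adj i j ≡ adj j i
    irrefl : ∀ i → adj i i ≡ false
open Graph public

edges : ∀ {n} → Graph n → ℕ
edges {n} G =
  sum (map (λ i → sum (map (λ j → if (toℕ i <ᵇ toℕ j) ∧ adj G i j then 1 else 0)
                           (allFin n)))
           (allFin n))

ContainsRel : ∀ {h n} → Graph h → (Fin n → Fin n → Bool) → Set
ContainsRel {h} {n} H R =
  Σ (Fin h → Fin n) λ f →
    Injective _≡_ _≡_ f × (∀ a b → T (adj H a b) → T (R (f a) (f b)))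

Contains : ∀ {h n} → Graph h → Graph n → Set
Contains H G = ContainsRel H (adj G)

addEdge : ∀ {n} → Graph n → Fin n → Fin n → (Fin n → Fin n → Bool)
addEdge G u v i j =
  adj G i j ∨ ((does (i ≟ u) ∧ does (j ≟ v)) ∨ (does (i ≟ v) ∧ does (j ≟ u)))

Saturated : ∀ {h n} → Graph h → Graph n → Set
Saturated H G =
  ¬ Contains H G ×
  (∀ u v → ¬ u ≡ v → adj G u v ≡ false → ContainsRel H (addEdge G u v))

IsSat : ∀ {h} → ℕ → Graph h → ℕ → Set
IsSat n H s =
  (Σ (Graph n) λ G → Saturated H G × edges G ≡ s) ×
  (∀ (G : Graph n) → Saturated H G → s ≤ edges G)

≡ᵇ-comm : ∀ a b → (a ≡ᵇ b) ≡ (b ≡ᵇ a)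
≡ᵇ-comm zero zero = refl
≡ᵇ-comm zero (suc b) = refl
≡ᵇ-comm (suc a) zero = refl
≡ᵇ-comm (suc a) (suc b) = ≡ᵇ-comm a b

≡ᵇ-refl : ∀ a → (a ≡ᵇ a) ≡ true
≡ᵇ-refl zero = refl
≡ᵇ-refl (suc a) = ≡ᵇ-refl a

suc≢ᵇ : ∀ a → (suc a ≡ᵇ a) ≡ false
suc≢ᵇ zero = refl
suc≢ᵇ (suc a) = suc≢ᵇ a

adjacentℕ : ℕ → ℕ → Bool
adjacentℕ a b = (suc a ≡ᵇ b) ∨ (suc b ≡ᵇ a)

adjacentℕ-sym : ∀ a b → adjacentℕ a b ≡ adjacentℕ b a
adjacentℕ-sym a b = ∨-comm (suc a ≡ᵇ b) (suc b ≡ᵇ a)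

adjacentℕ-irrefl : ∀ a → adjacentℕ a a ≡ false
adjacentℕ-irrefl a rewrite suc≢ᵇ a = refl

P : (k : ℕ) → Graph k
adj (P k) i j = adjacentℕ (toℕ i) (toℕ j)
sym (P k) i j = adjacentℕ-sym (toℕ i) (toℕ j)
irrefl (P k) i = adjacentℕ-irrefl (toℕ i)

-- K_2 ∨ P_k on vertices 0,…,k+1: vertices 0,1 form the K_2 part and are
-- adjacent to every other vertex; vertices 2,…,k+1 form the path P_k
-- (consecutive ones adjacent).
joinℕ : ℕ → ℕ → Bool
joinℕ a b = (((a <ᵇ 2) ∨ (b <ᵇ 2)) ∧ not (a ≡ᵇ b)) ∨ adjacentℕ a b

joinℕ-sym : ∀ a b → joinℕ a b ≡ joinℕ b a
joinℕ-sym a b =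
  cong₂ _∨_ (cong₂ _∧_ (∨-comm (a <ᵇ 2) (b <ᵇ 2)) (cong not (≡ᵇ-comm a b)))
            (adjacentℕ-sym a b)

joinℕ-irrefl : ∀ a → joinℕ a a ≡ false
joinℕ-irrefl a rewrite ≡ᵇ-refl a | adjacentℕ-irrefl a | ∧-comm ((a <ᵇ 2) ∨ (a <ᵇ 2)) false = refl

K2∨P : (k : ℕ) → Graph (2 + k)
adj (K2∨P k) i j = joinℕ (toℕ i) (toℕ j)
sym (K2∨P k) i j = joinℕ-sym (toℕ i) (toℕ j)
irrefl (K2∨P k) i = joinℕ-irrefl (toℕ i)

-- K₂ ∨ H is the cone over the cone over H, so it suffices to show that taking
-- the cone K₁ ∨ - preserves saturation and adds one edge per vertex of the base.
-- The apex is adjacent to everything, so the missing edges of K₁ ∨ G are those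
-- of G, and a copy of X in G + e extends to a copy of K₁ ∨ X in (K₁ ∨ G) + e.
-- Conversely a copy of K₁ ∨ X in K₁ ∨ G yields a copy of X in G: the vertex of
-- X sent to the apex (if any) is replaced by the apex of the pattern, which is
-- adjacent to every vertex of X and is itself mapped into G by injectivity.
module Submission where

open import Defs
open import Data.Nat using (ℕ; zero; suc; _+_; _*_; _∸_; _≤_; _<ᵇ_; s≤s)
open import Data.Nat.Properties using (+-identityʳ; +-suc; +-assoc; ≤-reflexive; m+n≤o⇒n≤o)
open import Data.Fin using (Fin; toℕ; lift; punchOut) renaming (zero to fz; suc to fs)
open import Data.Fin.Properties
  using (_≟_; 0≢1+n; suc-injective; lift-injective; punchOut-injective; punchIn-punchOut)
open import Data.Bool using (Bool; true; false; _∧_; if_then_else_; T)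
open import Data.List using (map)
open import Data.List.Base using (allFin)
open import Data.List.Properties using (map-tabulate; map-cong)
open import Data.Nat.ListAction using (sum)
open import Data.Product using (Σ; _×_; _,_)
open import Data.Empty using (⊥-elim)
open import Data.Unit using (tt)
open import Function using (_∘_; id)
open import Function.Definitions using (Injective)
open import Relation.Binary.PropositionalEquality
  using (_≡_; _≢_; refl; trans; cong; cong₂; subst; subst₂; module ≡-Reasoning)
  renaming (sym to ≡-sym)
open import Relation.Nullary using (¬_; yes; no)

private
  variable
    h m x y : ℕ

ContainsRel-antimonoˡ : {H H′ : Graph h} {R : Fin m → Fin m → Bool} →
                        (∀ a b → T (adj H′ a b) → T (adj H a b)) →
                        ContainsRel H R → ContainsRel H′ R
ContainsRel-antimonoˡ H′⊆H (f , f-inj , f-hom) =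
  f , f-inj , λ a b → f-hom a b ∘ H′⊆H a b

ContainsRel-monoʳ : {H : Graph h} {R S : Fin m → Fin m → Bool} →
                    (∀ u v → T (R u v) → T (S u v)) →
                    ContainsRel H R → ContainsRel H S
ContainsRel-monoʳ R⊆S (f , f-inj , f-hom) =
  f , f-inj , λ a b → R⊆S (f a) (f b) ∘ f-hom a b

Saturated-respˡ : {H H′ : Graph h} {G : Graph m} →
                  (∀ a b → adj H a b ≡ adj H′ a b) → Saturated H G → Saturated H′ G
Saturated-respˡ {H = H} {H′} {G} H≗H′ (H⊈G , H⊆G+e) =
  H⊈G ∘ ContainsRel-antimonoˡ {H = H′} {H} {adj G} H⊆H′ ,
  λ u v u≢v uv∉G → ContainsRel-antimonoˡ {H = H} {H′} {addEdge G u v} H′⊆H (H⊆G+e u v u≢v uv∉G)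
  where
  H⊆H′ : ∀ a b → T (adj H a b) → T (adj H′ a b)
  H⊆H′ a b = subst T (H≗H′ a b)
  H′⊆H : ∀ a b → T (adj H′ a b) → T (adj H a b)
  H′⊆H a b = subst T (≡-sym (H≗H′ a b))

cone : (Fin m → Fin m → Bool) → Fin (suc m) → Fin (suc m) → Bool
cone R fz     fz     = false
cone R fz     (fs _) = true
cone R (fs _) fz     = true
cone R (fs i) (fs j) = R i j

K₁∨_ : Graph m → Graph (suc m)
adj (K₁∨ G) = cone (adj G)
Graph.sym (K₁∨ G) fz     fz     = refl
Graph.sym (K₁∨ G) fz     (fs _) = refl
Graph.sym (K₁∨ G) (fs _) fz     = refl
Graph.sym (K₁∨ G) (fs i) (fs j) = Graph.sym G i j
irrefl (K₁∨ G) fz     = refl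
irrefl (K₁∨ G) (fs i) = irrefl G i

K₁∨K₁∨P≗K2∨P : ∀ k a b → adj (K₁∨ K₁∨ P k) a b ≡ adj (K2∨P k) a b
K₁∨K₁∨P≗K2∨P k fz          fz          = refl
K₁∨K₁∨P≗K2∨P k fz          (fs fz)     = refl
K₁∨K₁∨P≗K2∨P k fz          (fs (fs _)) = refl
K₁∨K₁∨P≗K2∨P k (fs fz)     fz          = refl
K₁∨K₁∨P≗K2∨P k (fs fz)     (fs fz)     = refl
K₁∨K₁∨P≗K2∨P k (fs fz)     (fs (fs _)) = refl
K₁∨K₁∨P≗K2∨P k (fs (fs _)) fz          = refl
K₁∨K₁∨P≗K2∨P k (fs (fs _)) (fs fz)     = refl
K₁∨K₁∨P≗K2∨P k (fs (fs _)) (fs (fs _)) = refl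

cone-preserves-containment : {X : Graph x} {R : Fin y → Fin y → Bool} →
                             ContainsRel X R → ContainsRel (K₁∨ X) (cone R)
cone-preserves-containment {X = X} {R} (f , f-inj , f-hom) =
  lift 1 f , lift-injective f f-inj 1 , lift-hom
  where
  lift-hom : ∀ a b → T (adj (K₁∨ X) a b) → T (cone R (lift 1 f a) (lift 1 f b))
  lift-hom fz     (fs _) _   = tt
  lift-hom (fs _) fz     _   = tt
  lift-hom (fs a) (fs b) a~b = f-hom a b a~b

module ConeReflection {X : Graph x} {R : Fin y → Fin y → Bool}
                      (f : Fin (suc x) → Fin (suc y)) (f-inj : Injective _≡_ _≡_ f)
                      (f-hom : ∀ a b → T (cone (adj X) a b) → T (cone R (f a) (f b))) where

  reroute : Fin x → Fin (suc x)
  reroute i with f (fs i) ≟ fz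
  ... | yes _ = fz
  ... | no  _ = fs i

  reroute-avoids-apex : ∀ i → fz ≢ f (reroute i)
  reroute-avoids-apex i with f (fs i) ≟ fz
  ... | yes fi≡0 = λ 0≡f0 → 0≢1+n (≡-sym (f-inj (trans fi≡0 0≡f0)))
  ... | no  fi≢0 = fi≢0 ∘ ≡-sym

  reroute-injective : Injective _≡_ _≡_ reroute
  reroute-injective {i} {j} eq with f (fs i) ≟ fz | f (fs j) ≟ fz | eq
  ... | yes fi≡0 | yes fj≡0 | _    = suc-injective (f-inj (trans fi≡0 (≡-sym fj≡0)))
  ... | no  _    | no  _    | refl = refl

  reroute-hom : ∀ i j → T (adj X i j) → T (cone (adj X) (reroute i) (reroute j))
  reroute-hom i j i~j with f (fs i) ≟ fz | f (fs j) ≟ fz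
  ... | yes fi≡0 | yes fj≡0 = ⊥-elim (subst T (irrefl X i) (subst (T ∘ adj X i) j≡i i~j))
    where j≡i : j ≡ i
          j≡i = suc-injective (f-inj (trans fj≡0 (≡-sym fi≡0)))
  ... | yes _    | no  _    = tt
  ... | no  _    | yes _    = tt
  ... | no  _    | no  _    = i~j

  base : Fin x → Fin y
  base i = punchOut (reroute-avoids-apex i)

  fs∘base≗f∘reroute : ∀ i → fs (base i) ≡ f (reroute i)
  fs∘base≗f∘reroute i = punchIn-punchOut (reroute-avoids-apex i)

  base-injective : Injective _≡_ _≡_ base
  base-injective =
    reroute-injective ∘ f-inj ∘ punchOut-injective (reroute-avoids-apex _) (reroute-avoids-apex _)

  base-hom : ∀ i j → T (adj X i j) → T (R (base i) (base j))
  base-hom i j =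
    subst₂ (λ u v → T (cone R u v)) (≡-sym (fs∘base≗f∘reroute i)) (≡-sym (fs∘base≗f∘reroute j))
    ∘ f-hom (reroute i) (reroute j) ∘ reroute-hom i j

cone-reflects-containment : {X : Graph x} {R : Fin y → Fin y → Bool} →
                            ContainsRel (K₁∨ X) (cone R) → ContainsRel X R
cone-reflects-containment {X = X} {R} (f , f-inj , f-hom) =
  base , base-injective , base-hom
  where open ConeReflection {X = X} {R} f f-inj f-hom

cone-addEdge : ∀ (G : Graph m) u v a b →
               cone (addEdge G u v) a b ≡ addEdge (K₁∨ G) (fs u) (fs v) a b
cone-addEdge G u v fz     fz     = refl
cone-addEdge G u v fz     (fs _) = refl
cone-addEdge G u v (fs _) fz     = refl
cone-addEdge G u v (fs _) (fs _) = refl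

cone-saturated : {X : Graph x} {G : Graph m} → Saturated X G → Saturated (K₁∨ X) (K₁∨ G)
cone-saturated {X = X} {G} (X⊈G , X⊆G+e) =
  X⊈G ∘ cone-reflects-containment {X = X} {adj G} , K₁∨X⊆K₁∨G+e
  where
  K₁∨X⊆K₁∨G+e : ∀ u v → ¬ u ≡ v → cone (adj G) u v ≡ false →
                ContainsRel (K₁∨ X) (addEdge (K₁∨ G) u v)
  K₁∨X⊆K₁∨G+e fz     fz     u≢v _ = ⊥-elim (u≢v refl)
  K₁∨X⊆K₁∨G+e fz     (fs _) _   ()
  K₁∨X⊆K₁∨G+e (fs _) fz     _   ()
  K₁∨X⊆K₁∨G+e (fs u) (fs v) u≢v uv∉G =
    ContainsRel-monoʳ {H = K₁∨ X} {cone (addEdge G u v)} (λ a b → subst T (cone-addEdge G u v a b))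
      (cone-preserves-containment {X = X} (X⊆G+e u v (u≢v ∘ cong fs) uv∉G))

sum-map-allFin-suc : ∀ {n} (g : Fin (suc n) → ℕ) →
                     sum (map g (allFin (suc n))) ≡ g fz + sum (map (g ∘ fs) (allFin n))
sum-map-allFin-suc g =
  trans (cong sum (map-tabulate id g))
        (cong (λ xs → g fz + sum xs) (≡-sym (map-tabulate id (g ∘ fs))))

sum-map-allFin-const-1 : ∀ n → sum (map (λ (_ : Fin n) → 1) (allFin n)) ≡ n
sum-map-allFin-const-1 zero    = refl
sum-map-allFin-const-1 (suc n) =
  trans (sum-map-allFin-suc {n} (λ _ → 1)) (cong suc (sum-map-allFin-const-1 n))

edgeIndicator : Graph m → Fin m → Fin m → ℕ
edgeIndicator G i j = if (toℕ i <ᵇ toℕ j) ∧ adj G i j then 1 else 0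

forwardDegree : Graph m → Fin m → ℕ
forwardDegree {m} G i = sum (map (edgeIndicator G i) (allFin m))

edges-cone : (G : Graph m) → edges (K₁∨ G) ≡ m + edges G
edges-cone {m} G = begin
  edges (K₁∨ G)
    ≡⟨ sum-map-allFin-suc (forwardDegree (K₁∨ G)) ⟩
  forwardDegree (K₁∨ G) fz + sum (map (forwardDegree (K₁∨ G) ∘ fs) (allFin m))
    ≡⟨ cong₂ _+_ (sum-map-allFin-suc (edgeIndicator (K₁∨ G) fz))
                 (cong sum (map-cong (sum-map-allFin-suc ∘ edgeIndicator (K₁∨ G) ∘ fs) (allFin m))) ⟩
  sum (map (λ _ → 1) (allFin m)) + edges G
    ≡⟨ cong (_+ edges G) (sum-map-allFin-const-1 m) ⟩
  m + edges G ∎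
  where open ≡-Reasoning

2*[2+m]∸3≡1+m+m : ∀ m → 2 * (2 + m) ∸ 3 ≡ suc m + m
2*[2+m]∸3≡1+m+m m rewrite +-identityʳ m | +-suc m (suc m) | +-suc m m = refl

edges-K₁∨K₁∨ : (G : Graph m) → edges (K₁∨ K₁∨ G) ≡ (2 * (2 + m) ∸ 3) + edges G
edges-K₁∨K₁∨ {m} G = begin
  edges (K₁∨ K₁∨ G)         ≡⟨ edges-cone (K₁∨ G) ⟩
  suc m + edges (K₁∨ G)     ≡⟨ cong (suc m +_) (edges-cone G) ⟩
  suc m + (m + edges G)     ≡⟨ +-assoc (suc m) m (edges G) ⟨
  suc m + m + edges G       ≡⟨ cong (_+ edges G) (2*[2+m]∸3≡1+m+m m) ⟨
  2 * (2 + m) ∸ 3 + edges G ∎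
  where open ≡-Reasoning

K₁∨K₁∨-saturated : ∀ k (G : Graph m) → Saturated (P k) G → Saturated (K2∨P k) (K₁∨ K₁∨ G)
K₁∨K₁∨-saturated k G =
  Saturated-respˡ {H = K₁∨ K₁∨ P k} {K2∨P k} {K₁∨ K₁∨ G} (K₁∨K₁∨P≗K2∨P k)
  ∘ cone-saturated {X = K₁∨ P k} {K₁∨ G}
  ∘ cone-saturated {X = P k} {G}

proposition2p5 : (k n : ℕ) → k + 2 ≤ n → (s : ℕ) → IsSat (n ∸ 2) (P k) s →
    Σ (Graph n) λ G → Saturated (K2∨P k) G × edges G ≤ (2 * n ∸ 3) + s
proposition2p5 k zero k+2≤n _ _ with m+n≤o⇒n≤o k k+2≤n
... | ()
proposition2p5 k (suc zero) k+2≤n _ _ with m+n≤o⇒n≤o k k+2≤n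
... | s≤s ()
proposition2p5 k (suc (suc m)) _ s ((H , H-saturated , edges-H≡s) , _) =
  K₁∨ K₁∨ H ,
  K₁∨K₁∨-saturated k H H-saturated ,
  ≤-reflexive (trans (edges-K₁∨K₁∨ H) (cong (2 * (2 + m) ∸ 3 +_) edges-H≡s))
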